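{- Let $n\ge 4$ be even and $S_f=\{f,rf,r^{n/2}\}\subseteq D_n$. Then (a) $\lambda_1(D_n,S_f)=\frac{n}{2}$ and (b) $\lambda_2(D_n,S_f)=\lambda_1(D_n,S_f)$.
   Context: The dihedral group $D_n$ is the group of order $2n$ with presentation $\langle r,f\mid r^n=f^2=1,\ rf=fr^{ -1}\rangle$. For a generating set $S$ of a finite group $G$ and $g\in G$, $l_S(g)$ is the minimal number of factors in an expression of $g$ as a product of elements of $S$ ($l_S(1)=0$). Define $\lambda_1(G,S)=\max_{g\in G,\,s\in S} l_S(gsg^{ -1})$ and $\lambda_2(G,S)=\max_{g\in G,\,s,s'\in S} l_S(gss'g^{ -1})$. -}

module Defs where

open import Data.Nat using (ℕ; zero; suc; _+_; _∸_; _≤_; NonZero)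
open import Data.Nat.DivMod using (_mod_)
open import Data.Fin using (Fin; toℕ)
open import Data.Bool using (Bool; true; false; _xor_)
open import Data.Product using (_×_; _,_; Σ; ∃)
open import Data.List using (List; []; _∷_; length)
open import Data.List.Relation.Unary.All using (All)
open import Data.List.Membership.Propositional using (_∈_)
open import Relation.Binary.PropositionalEquality using (_≡_)

-- The dihedral group D_n of order 2n, realised concretely:
-- the pair (a , e) stands for r^a f^e  (a ∈ ℤ/n, e ∈ {0,1}).
D : (n : ℕ) → Set
D n = Fin n × Bool

module _ (n : ℕ) .{{_ : NonZero n}} where

  _⊕_ : Fin n → Fin n → Fin n
  a ⊕ b = (toℕ a + toℕ b) mod n

  ⊖_ : Fin n → Fin n
  ⊖ a = (n ∸ toℕ a) mod n

  -- (r^a f^e)(r^b f^e') = r^(a + (-1)^e b) f^(e xor e'), using f r^b = r^(-b) f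
  mul : D n → D n → D n
  mul (a , false) (b , e') = (a ⊕ b , e')
  mul (a , true)  (b , e') = (a ⊕ (⊖ b) , true xor e')

  one : D n
  one = (0 mod n , false)

  inv : D n → D n
  inv (a , false) = (⊖ a , false)
  inv (a , true)  = (a , true)

  r^ : ℕ → D n
  r^ k = (k mod n , false)

  r^f : ℕ → D n
  r^f k = (k mod n , true)

  prod : List (D n) → D n
  prod []       = one
  prod (x ∷ xs) = mul x (prod xs)

  IsLength : List (D n) → D n → ℕ → Set
  IsLength S g k =
    (Σ (List (D n)) λ w → All (_∈ S) w × prod w ≡ g × length w ≡ k)
    × (∀ (w : List (D n)) → All (_∈ S) w → prod w ≡ g → k ≤ length w)

  conj : D n → D n → D n
  conj g x = mul (mul g x) (inv g)

  IsLambda1 : List (D n) → ℕ → Set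
  IsLambda1 S m =
    (∃ λ g → Σ (D n) λ s → s ∈ S × IsLength S (conj g s) m)
    × (∀ g s k → s ∈ S → IsLength S (conj g s) k → k ≤ m)

  IsLambda2 : List (D n) → ℕ → Set
  IsLambda2 S m =
    (∃ λ g → Σ (D n) λ s → Σ (D n) λ s' → s ∈ S × s' ∈ S × IsLength S (conj g (mul s s')) m)
    × (∀ g s s' k → s ∈ S → s' ∈ S → IsLength S (conj g (mul s s')) k → k ≤ m)

module Submission where

-- Label r^b by the position 2b and r^c f by the position 2(-c) + 1 of the cycle
-- ℤ/2n.  Left multiplication by f or rf moves a position by ±1 and left
-- multiplication by the central involution z = r^k moves it by n, so the Cayley
-- graph of (D_n, S_f) is the 2n-cycle together with its antipodal chords.  In
-- this graph every vertex lies within distance k of the identity (a walk along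
-- the cycle, possibly followed by one chord), while a path of L steps from 0
-- stays within cycle distance L of 0 or within L - 1 of n; hence the positions
-- k, k + 1, 3k - 1, 3k are at distance exactly k.  The reflection at position
-- 2⌊k/2⌋ + 1 is such a far vertex, and every reflection is conjugate by a
-- rotation both to f or rf and to z f or z rf, so both maxima equal k = n/2.

open import Defs
open import Algebra.Bundles using (AbelianGroup)
open import Algebra.Structures using (IsAbelianGroup)
import Algebra.Properties.AbelianGroup as AbelianGroupProperties
open import Data.Nat using (ℕ; zero; suc; _+_; _*_; _∸_; _≤_; _<_; z≤n; s≤s; s≤s⁻¹; NonZero; _%_; >-nonZero⁻¹; _≤?_; _<?_)
open import Data.Nat.Properties
open import Data.Nat.DivMod using (_mod_; m<n⇒m%n≡m; %-distribˡ-+; m%n%n≡m%n; n%n≡0; [m+n]%n≡m%n)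
open import Data.Fin using (Fin; toℕ)
open import Data.Fin.Properties using (toℕ-fromℕ<; toℕ-injective; toℕ<n)
open import Data.Product using (_×_; _,_; Σ)
open import Data.List using (List; []; _∷_; length)
open import Data.List.Relation.Unary.All using (All; []; _∷_)
open import Data.List.Membership.Propositional using (_∈_)
open import Data.List.Relation.Unary.Any using (here; there)
open import Data.Bool using (true; false)
open import Data.Sum using (_⊎_; inj₁; inj₂)
open import Data.Empty using (⊥-elim)
open import Relation.Nullary using (yes; no)
open import Data.Nat.Tactic.RingSolver using (solve-∀)
open import Relation.Binary.PropositionalEquality hiding ([_])

module ZMod (n : ℕ) .{{_ : NonZero n}} where

  infixl 6 _+ₙ_
  _+ₙ_ : Fin n → Fin n → Fin n
  _+ₙ_ = _⊕_ n

  -ₙ_ : Fin n → Fin n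
  -ₙ_ = ⊖_ n

  [_] : ℕ → Fin n
  [ a ] = a mod n

  toℕ-[] : ∀ a → toℕ [ a ] ≡ a % n
  toℕ-[] a = toℕ-fromℕ< _

  toℕ-[<n] : ∀ {a} → a < n → toℕ [ a ] ≡ a
  toℕ-[<n] {a} a<n = trans (toℕ-[] a) (m<n⇒m%n≡m a<n)

  toℕ-+ₙ : ∀ a b → toℕ (a +ₙ b) ≡ (toℕ a + toℕ b) % n
  toℕ-+ₙ a b = toℕ-fromℕ< _

  toℕ--ₙ : ∀ a → toℕ (-ₙ a) ≡ (n ∸ toℕ a) % n
  toℕ--ₙ a = toℕ-fromℕ< _

  toℕ%n : ∀ (a : Fin n) → toℕ a % n ≡ toℕ a
  toℕ%n a = m<n⇒m%n≡m (toℕ<n a)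

  %-absorbˡ : ∀ a b → (a % n + b) % n ≡ (a + b) % n
  %-absorbˡ a b = begin
    (a % n + b) % n           ≡⟨ %-distribˡ-+ (a % n) b n ⟩
    (a % n % n + b % n) % n   ≡⟨ cong (λ t → (t + b % n) % n) (m%n%n≡m%n a n) ⟩
    (a % n + b % n) % n       ≡⟨ %-distribˡ-+ a b n ⟨
    (a + b) % n               ∎
    where open ≡-Reasoning

  %-absorbʳ : ∀ a b → (a + b % n) % n ≡ (a + b) % n
  %-absorbʳ a b = begin
    (a + b % n) % n  ≡⟨ cong (_% n) (+-comm a (b % n)) ⟩
    (b % n + a) % n  ≡⟨ %-absorbˡ b a ⟩
    (b + a) % n      ≡⟨ cong (_% n) (+-comm b a) ⟩
    (a + b) % n      ∎
    where open ≡-Reasoning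

  []-homo : ∀ a b → [ a ] +ₙ [ b ] ≡ [ a + b ]
  []-homo a b = toℕ-injective (begin
    toℕ ([ a ] +ₙ [ b ])       ≡⟨ toℕ-+ₙ [ a ] [ b ] ⟩
    (toℕ [ a ] + toℕ [ b ]) % n ≡⟨ cong₂ (λ u v → (u + v) % n) (toℕ-[] a) (toℕ-[] b) ⟩
    (a % n + b % n) % n        ≡⟨ %-distribˡ-+ a b n ⟨
    (a + b) % n                ≡⟨ toℕ-[] (a + b) ⟨
    toℕ [ a + b ]              ∎)
    where open ≡-Reasoning

  []-toℕ : ∀ a → [ toℕ a ] ≡ a
  []-toℕ a = toℕ-injective (trans (toℕ-[] (toℕ a)) (toℕ%n a))

  []-+n : ∀ a → [ a + n ] ≡ [ a ]
  []-+n a = toℕ-injective (trans (toℕ-[] (a + n)) (trans ([m+n]%n≡m%n a n) (sym (toℕ-[] a))))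

  +-comm-ℤ : ∀ a b → a +ₙ b ≡ b +ₙ a
  +-comm-ℤ a b = toℕ-injective (begin
    toℕ (a +ₙ b)            ≡⟨ toℕ-+ₙ a b ⟩
    (toℕ a + toℕ b) % n     ≡⟨ cong (_% n) (+-comm (toℕ a) (toℕ b)) ⟩
    (toℕ b + toℕ a) % n     ≡⟨ toℕ-+ₙ b a ⟨
    toℕ (b +ₙ a)            ∎)
    where open ≡-Reasoning

  +-assoc-ℤ : ∀ a b c → (a +ₙ b) +ₙ c ≡ a +ₙ (b +ₙ c)
  +-assoc-ℤ a b c = toℕ-injective (begin
    toℕ ((a +ₙ b) +ₙ c)                  ≡⟨ toℕ-+ₙ (a +ₙ b) c ⟩
    (toℕ (a +ₙ b) + toℕ c) % n           ≡⟨ cong (λ t → (t + toℕ c) % n) (toℕ-+ₙ a b) ⟩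
    ((toℕ a + toℕ b) % n + toℕ c) % n    ≡⟨ %-absorbˡ (toℕ a + toℕ b) (toℕ c) ⟩
    (toℕ a + toℕ b + toℕ c) % n          ≡⟨ cong (_% n) (+-assoc (toℕ a) (toℕ b) (toℕ c)) ⟩
    (toℕ a + (toℕ b + toℕ c)) % n        ≡⟨ %-absorbʳ (toℕ a) (toℕ b + toℕ c) ⟨
    (toℕ a + (toℕ b + toℕ c) % n) % n    ≡⟨ cong (λ t → (toℕ a + t) % n) (toℕ-+ₙ b c) ⟨
    (toℕ a + toℕ (b +ₙ c)) % n           ≡⟨ toℕ-+ₙ a (b +ₙ c) ⟨
    toℕ (a +ₙ (b +ₙ c))                  ∎)
    where open ≡-Reasoning

  +-identityˡ-ℤ : ∀ a → [ 0 ] +ₙ a ≡ a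
  +-identityˡ-ℤ a = trans (cong ([ 0 ] +ₙ_) (sym ([]-toℕ a))) (trans ([]-homo 0 (toℕ a)) ([]-toℕ a))

  +-identityʳ-ℤ : ∀ a → a +ₙ [ 0 ] ≡ a
  +-identityʳ-ℤ a = trans (+-comm-ℤ a [ 0 ]) (+-identityˡ-ℤ a)

  -ₙ-inverseʳ : ∀ a → a +ₙ (-ₙ a) ≡ [ 0 ]
  -ₙ-inverseʳ a = toℕ-injective (begin
    toℕ (a +ₙ (-ₙ a))                     ≡⟨ toℕ-+ₙ a (-ₙ a) ⟩
    (toℕ a + toℕ (-ₙ a)) % n              ≡⟨ cong (λ t → (toℕ a + t) % n) (toℕ--ₙ a) ⟩
    (toℕ a + (n ∸ toℕ a) % n) % n         ≡⟨ %-absorbʳ (toℕ a) (n ∸ toℕ a) ⟩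
    (toℕ a + (n ∸ toℕ a)) % n             ≡⟨ cong (_% n) (m+[n∸m]≡n (<⇒≤ (toℕ<n a))) ⟩
    n % n                                 ≡⟨ n%n≡0 n ⟩
    0                                     ≡⟨ m<n⇒m%n≡m (>-nonZero⁻¹ n) ⟨
    0 % n                                 ≡⟨ toℕ-[] 0 ⟨
    toℕ [ 0 ]                             ∎)
    where open ≡-Reasoning

  -ₙ-inverseˡ : ∀ a → (-ₙ a) +ₙ a ≡ [ 0 ]
  -ₙ-inverseˡ a = trans (+-comm-ℤ (-ₙ a) a) (-ₙ-inverseʳ a)

  isAbelianGroup : IsAbelianGroup _≡_ _+ₙ_ [ 0 ] -ₙ_
  isAbelianGroup = record
    { isGroup = record
      { isMonoid = record
        { isSemigroup = record
          { isMagma = record { isEquivalence = isEquivalence ; ∙-cong = cong₂ _+ₙ_ }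
          ; assoc = +-assoc-ℤ }
        ; identity = +-identityˡ-ℤ , +-identityʳ-ℤ }
      ; inverse = -ₙ-inverseˡ , -ₙ-inverseʳ
      ; ⁻¹-cong = cong -ₙ_ }
    ; comm = +-comm-ℤ }

  abelianGroup : AbelianGroup _ _
  abelianGroup = record { isAbelianGroup = isAbelianGroup }

  open AbelianGroupProperties abelianGroup public
    using (⁻¹-involutive; ⁻¹-injective; ⁻¹-∙-comm; inverseʳ-unique)


parity : ∀ t → Σ ℕ λ j → Σ ℕ λ e → e ≤ 1 × j + e + j ≡ t
parity zero = 0 , 0 , z≤n , refl
parity (suc zero) = 0 , 1 , s≤s z≤n , refl
parity (suc (suc t)) with parity t
... | j , e , e≤1 , j+e+j≡t = suc j , e , e≤1 , cong suc (trans (+-suc (j + e) j) (cong suc j+e+j≡t))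

-- This is the Cayley graph of D_n for S_f (see pos below);
-- here we study its metric: which positions can be reached in L steps from 0.
module Cycle (k : ℕ) .{{_ : NonZero k}} where

  n : ℕ
  n = 2 * k

  N : ℕ
  N = 2 * n

  instance
    n-nonZero : NonZero n
    n-nonZero = m*n≢0 2 k

  n≡k+k : n ≡ k + k
  n≡k+k = cong (k +_) (+-identityʳ k)

  N≡n+n : N ≡ n + n
  N≡n+n = cong (n +_) (+-identityʳ n)

  N≡k+n+k : N ≡ k + n + k
  N≡k+n+k = begin
    N              ≡⟨ N≡n+n ⟩
    n + n          ≡⟨ cong (_+ n) n≡k+k ⟩
    k + k + n      ≡⟨ +-assoc k k n ⟩
    k + (k + n)    ≡⟨ cong (k +_) (+-comm k n) ⟩
    k + (n + k)    ≡⟨ +-assoc k n k ⟨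
    k + n + k      ∎
    where open ≡-Reasoning

  -- k ≥ 1 gives 1 < k + 1 ≤ n, so the rotation parts 1 and k of rf and z are reduced
  k<n : k < n
  k<n = subst (k <_) (sym n≡k+k) (m<m+n k (>-nonZero⁻¹ k))

  n<N : n < N
  n<N = subst (n <_) (sym N≡n+n) (m<m+n n (>-nonZero⁻¹ n))

  1<n : 1 < n
  1<n = ≤-trans (s≤s (>-nonZero⁻¹ k)) k<n

  lt-suc : ∀ {a} c L → a ≤ c + L → a < c + suc L
  lt-suc c L a≤c+L = ≤-trans (s≤s a≤c+L) (≤-reflexive (sym (+-suc c L)))

  Succ : ℕ → ℕ → Set
  Succ p q = suc p ≡ q ⊎ (suc p ≡ N × q ≡ 0)

  Adjacent : ℕ → ℕ → Set
  Adjacent p q = Succ p q ⊎ Succ q p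

  Antipodal : ℕ → ℕ → Set
  Antipodal p q = q ≡ p + n ⊎ q + n ≡ p

  NearZero : ℕ → ℕ → Set
  NearZero L p = p ≤ L ⊎ N ≤ p + L

  -- p is within cycle distance L - 1 of n, i.e. reachable from 0 in L steps via a chord
  NearHalf : ℕ → ℕ → Set
  NearHalf L p = p < n + L × n < p + L

  -- every position reachable from 0 in a path of L steps satisfies Reach L
  Reach : ℕ → ℕ → Set
  Reach L p = NearZero L p ⊎ NearHalf L p

  nearZero-succ : ∀ {L p q} → Succ p q → NearZero L p → NearZero (suc L) q
  nearZero-succ (inj₁ refl) (inj₁ p≤L) = inj₁ (s≤s p≤L)
  nearZero-succ {L} {p} (inj₁ refl) (inj₂ N≤p+L) = inj₂ (≤-trans N≤p+L (+-mono-≤ (n≤1+n p) (n≤1+n L)))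
  nearZero-succ (inj₂ (_ , refl)) _ = inj₁ z≤n

  nearZero-pred : ∀ {L p q} → Succ q p → NearZero L p → NearZero (suc L) q
  nearZero-pred {L} {q = q} (inj₁ refl) (inj₁ sq≤L) = inj₁ (≤-trans (n≤1+n q) (≤-trans sq≤L (n≤1+n L)))
  nearZero-pred {L} {q = q} (inj₁ refl) (inj₂ N≤sq+L) = inj₂ (≤-trans N≤sq+L (≤-reflexive (sym (+-suc q L))))
  nearZero-pred {L} {q = q} (inj₂ (sq≡N , refl)) _ = inj₂ (≤-trans (≤-reflexive (sym sq≡N)) (lt-suc q L (m≤m+n q L)))

  nearHalf-succ : ∀ {L p q} → Succ p q → NearHalf L p → NearHalf (suc L) q
  nearHalf-succ {L} {p} (inj₁ refl) (p<n+L , n<p+L) =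
    lt-suc n L p<n+L , ≤-trans n<p+L (+-mono-≤ (n≤1+n p) (n≤1+n L))
  nearHalf-succ {L} (inj₂ (sp≡N , refl)) (p<n+L , _) = lt-suc n L z≤n , s≤s n≤L
    where n≤L : n ≤ L
          n≤L = +-cancelˡ-≤ n n L (≤-trans (≤-reflexive (sym (trans sp≡N N≡n+n))) p<n+L)

  nearHalf-pred : ∀ {L p q} → Succ q p → NearHalf L p → NearHalf (suc L) q
  nearHalf-pred {L} {q = q} (inj₁ refl) (sq<n+L , n<sq+L) =
    ≤-trans (<⇒≤ sq<n+L) (+-monoʳ-≤ n (n≤1+n L)) , ≤-trans n<sq+L (≤-reflexive (sym (+-suc q L)))
  nearHalf-pred {L} {q = q} (inj₂ (sq≡N , refl)) (_ , n<L) =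
    ≤-trans (≤-reflexive (trans sq≡N N≡n+n)) (+-monoʳ-≤ n (≤-trans (<⇒≤ n<L) (n≤1+n L))) ,
    ≤-trans n<L (≤-trans (n≤1+n L) (m≤n+m (suc L) q))

  nearZero-antipodal : ∀ {L p q} → Antipodal p q → p < N → q < N → NearZero L p → NearHalf (suc L) q
  nearZero-antipodal {L} {p} (inj₁ refl) _ q<N near =
    lt-suc n L (≤-trans (+-monoˡ-≤ n (p≤L near)) (≤-reflexive (+-comm L n))) ,
    lt-suc (p + n) L (≤-trans (m≤n+m n p) (m≤m+n (p + n) L))
    where
      -- p + n < N forces p < n, so p can only be near 0 from below
      p<n : p < n
      p<n = +-cancelʳ-< n p n (<-≤-trans q<N (≤-reflexive N≡n+n))
      p≤L : NearZero L p → p ≤ L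
      p≤L (inj₁ p≤L) = p≤L
      p≤L (inj₂ N≤p+L) =
        <⇒≤ (<-trans p<n (+-cancelˡ-< n n L (≤-<-trans (≤-trans (≤-reflexive (sym N≡n+n)) N≤p+L) (+-monoˡ-< L p<n))))
  nearZero-antipodal {L} {q = q} (inj₂ refl) p<N _ (inj₁ q+n≤L) =
    lt-suc n L (≤-trans (m≤m+n q n) (≤-trans q+n≤L (m≤n+m L n))) ,
    lt-suc q L (≤-trans (m≤n+m n q) (≤-trans q+n≤L (m≤n+m L q)))
  nearZero-antipodal {L} {q = q} (inj₂ refl) p<N _ (inj₂ N≤q+n+L) =
    ≤-trans q<n (m≤m+n n (suc L)) , lt-suc q L n≤q+L
    where
      q<n : q < n
      q<n = +-cancelʳ-< n q n (<-≤-trans p<N (≤-reflexive N≡n+n))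
      n≤q+L : n ≤ q + L
      n≤q+L = +-cancelʳ-≤ n n (q + L) (begin
        n + n          ≡⟨ N≡n+n ⟨
        N              ≤⟨ N≤q+n+L ⟩
        q + n + L      ≡⟨ +-assoc q n L ⟩
        q + (n + L)    ≡⟨ cong (q +_) (+-comm n L) ⟩
        q + (L + n)    ≡⟨ +-assoc q L n ⟨
        q + L + n      ∎)
        where open ≤-Reasoning

  nearHalf-antipodal : ∀ {L p q} → Antipodal p q → NearHalf L p → NearZero (suc L) q
  nearHalf-antipodal {L} {p} (inj₁ refl) (_ , n<p+L) = inj₂ (begin
    N                ≡⟨ N≡n+n ⟩
    n + n            ≤⟨ +-monoˡ-≤ n (<⇒≤ n<p+L) ⟩
    p + L + n        ≡⟨ +-assoc p L n ⟩
    p + (L + n)      ≡⟨ cong (p +_) (+-comm L n) ⟩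
    p + (n + L)      ≡⟨ +-assoc p n L ⟨
    p + n + L        ≤⟨ +-monoʳ-≤ (p + n) (n≤1+n L) ⟩
    p + n + suc L    ∎)
    where open ≤-Reasoning
  nearHalf-antipodal {L} {q = q} (inj₂ refl) (q+n<n+L , _) =
    inj₁ (m<n⇒m≤1+n (+-cancelʳ-< n q L (<-≤-trans q+n<n+L (≤-reflexive (+-comm n L)))))

  reach-origin : Reach 0 0
  reach-origin = inj₁ (inj₁ z≤n)

  reach-adjacent : ∀ {L p q} → Adjacent p q → Reach L p → Reach (suc L) q
  reach-adjacent (inj₁ s) (inj₁ r) = inj₁ (nearZero-succ s r)
  reach-adjacent (inj₁ s) (inj₂ r) = inj₂ (nearHalf-succ s r)
  reach-adjacent (inj₂ s) (inj₁ r) = inj₁ (nearZero-pred s r)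
  reach-adjacent (inj₂ s) (inj₂ r) = inj₂ (nearHalf-pred s r)

  reach-antipodal : ∀ {L p q} → Antipodal p q → p < N → q < N → Reach L p → Reach (suc L) q
  reach-antipodal a p<N q<N (inj₁ r) = inj₂ (nearZero-antipodal a p<N q<N r)
  reach-antipodal a _ _ (inj₂ r) = inj₁ (nearHalf-antipodal a r)

  -- the positions at cycle distance exactly k: near k and near its antipode k + n
  Far : ℕ → Set
  Far p = (k ≤ p × p ≤ suc k) ⊎ (k + n ≤ suc p × p ≤ k + n)

  suc-k≤k+n : suc k ≤ k + n
  suc-k≤k+n = m<m+n k (>-nonZero⁻¹ n)

  far-low : ∀ {p} → Far p → k ≤ p
  far-low (inj₁ (k≤p , _)) = k≤p
  far-low (inj₂ (k+n≤sp , _)) = s≤s⁻¹ (≤-trans suc-k≤k+n k+n≤sp)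

  far-high : ∀ {p} → Far p → p ≤ k + n
  far-high (inj₁ (_ , p≤sk)) = ≤-trans p≤sk suc-k≤k+n
  far-high (inj₂ (_ , p≤k+n)) = p≤k+n

  far-unreachable : ∀ {L p} → Reach L p → Far p → k ≤ L
  far-unreachable (inj₁ (inj₁ p≤L)) far = ≤-trans (far-low far) p≤L
  far-unreachable {L} {p} (inj₁ (inj₂ N≤p+L)) far = +-cancelˡ-≤ (k + n) k L (begin
    k + n + k   ≡⟨ N≡k+n+k ⟨
    N           ≤⟨ N≤p+L ⟩
    p + L       ≤⟨ +-monoˡ-≤ L (far-high far) ⟩
    k + n + L   ∎)
    where open ≤-Reasoning
  far-unreachable {L} {p} (inj₂ (_ , n<p+L)) (inj₁ (_ , p≤sk)) = +-cancelˡ-≤ k k L (s≤s⁻¹ (begin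
    suc (k + k)   ≡⟨ cong suc n≡k+k ⟨
    suc n         ≤⟨ n<p+L ⟩
    p + L         ≤⟨ +-monoˡ-≤ L p≤sk ⟩
    suc (k + L)   ∎))
    where open ≤-Reasoning
  far-unreachable {L} (inj₂ (p<n+L , _)) (inj₂ (k+n≤sp , _)) =
    +-cancelʳ-≤ n k L (≤-trans k+n≤sp (≤-trans p<n+L (≤-reflexive (+-comm n L))))

  far-odd : ∀ y e → e ≤ 1 → y + e + y ≡ k → Far (suc (2 * y))
  far-odd y e e≤1 refl = inj₁ (k≤ , s≤s (≤-trans (≤-reflexive 2y≡y+y) (+-monoˡ-≤ y (m≤m+n y e))))
    where
      2y≡y+y : 2 * y ≡ y + y
      2y≡y+y = cong (y +_) (+-identityʳ y)
      k≤ : y + e + y ≤ suc (2 * y)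
      k≤ = begin
        y + e + y      ≤⟨ +-monoˡ-≤ y (+-monoʳ-≤ y e≤1) ⟩
        y + 1 + y      ≡⟨ +-assoc y 1 y ⟩
        y + suc y      ≡⟨ +-suc y y ⟩
        suc (y + y)    ≡⟨ cong suc 2y≡y+y ⟨
        suc (2 * y)    ∎
        where open ≤-Reasoning

  antipodal-low : ∀ {p q} → Antipodal p q → p < n → q ≡ p + n
  antipodal-low (inj₁ q≡p+n) _ = q≡p+n
  antipodal-low {q = q} (inj₂ refl) q+n<n = ⊥-elim (<-irrefl refl (≤-<-trans (m≤n+m n q) q+n<n))

  antipodal-high : ∀ {p q} → Antipodal p q → q < N → n ≤ p → q + n ≡ p
  antipodal-high {p} (inj₁ refl) p+n<N n≤p =
    ⊥-elim (<-irrefl refl (<-≤-trans p+n<N (≤-trans (≤-reflexive N≡n+n) (+-monoˡ-≤ n n≤p))))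
  antipodal-high (inj₂ q+n≡p) _ _ = q+n≡p

  -- every position p < N is reached from 0 by a path of at most k steps of one of
  -- four shapes: p steps forwards; j + 1 steps backwards; d steps forwards to p - n
  -- followed by a chord; j + 1 steps backwards to p + n followed by a chord
  data Route (p : ℕ) : Set where
    forward        : p ≤ k → Route p
    backward       : ∀ j → p + suc j ≡ N → suc j ≤ k → Route p
    chord-forward  : ∀ d → d + n ≡ p → suc d ≤ k → Route p
    chord-backward : ∀ j → n + p + suc j ≡ N → suc (suc j) ≤ k → Route p

  route : ∀ p → p < N → Route p
  route p p<N with p ≤? k
  ... | yes p≤k = forward p≤k
  ... | no p≰k with p <? n
  ...   | yes p<n = let (j , sp+j≡n) = m≤n⇒∃[o]m+o≡n p<n in
    chord-backward j
      (trans (+-assoc n p (suc j)) (trans (cong (n +_) (trans (+-suc p j) sp+j≡n)) (sym N≡n+n)))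
      (+-cancelʳ-≤ k (suc (suc j)) k (begin
        suc (suc (j + k))   ≡⟨ cong (λ t → suc (suc t)) (+-comm j k) ⟩
        suc (suc k) + j     ≤⟨ s≤s (+-monoˡ-≤ j (≰⇒> p≰k)) ⟩
        suc p + j           ≡⟨ trans sp+j≡n n≡k+k ⟩
        k + k               ∎))
    where open ≤-Reasoning
  ...   | no p≮n with p <? k + n
  ...     | yes p<k+n = let (d , n+d≡p) = m≤n⇒∃[o]m+o≡n (≮⇒≥ p≮n) in
    chord-forward d (trans (+-comm d n) n+d≡p)
      (+-cancelʳ-< n d k (subst (_< k + n) (trans (sym n+d≡p) (+-comm n d)) p<k+n))
  ...     | no p≮k+n = let (j , sp+j≡N) = m≤n⇒∃[o]m+o≡n p<N in
    backward j (trans (+-suc p j) sp+j≡N)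
      (+-cancelˡ-≤ (k + n) (suc j) k (begin
        k + n + suc j   ≤⟨ +-monoˡ-≤ (suc j) (≮⇒≥ p≮k+n) ⟩
        p + suc j       ≡⟨ trans (+-suc p j) sp+j≡N ⟩
        N               ≡⟨ N≡k+n+k ⟩
        k + n + k       ∎))
    where open ≤-Reasoning

  -- How adding the residues 1, n - 1 and k in ℤ/n moves even and odd positions;
  -- these are the rotation parts met when rf, f and z act (see Dihedral).

  cycle-succ : ∀ y → y < n → Succ (suc (2 * y)) (2 * ((1 + y) % n))
  cycle-succ y y<n with m≤n⇒m<n∨m≡n y<n
  ... | inj₁ sy<n = inj₁ (sym (trans (cong (2 *_) (m<n⇒m%n≡m sy<n)) (*-suc 2 y)))
  ... | inj₂ sy≡n = inj₂ (trans (sym (*-suc 2 y)) (cong (2 *_) sy≡n) ,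
                          cong (2 *_) (trans (cong (_% n) sy≡n) (n%n≡0 n)))

  suc[n∸1]≡n : suc (n ∸ 1) ≡ n
  suc[n∸1]≡n = trans (+-comm 1 (n ∸ 1)) (m∸n+n≡m (>-nonZero⁻¹ n))

  cycle-pred : ∀ y → y < n → Succ (suc (2 * ((n ∸ 1 + y) % n))) (2 * y)
  cycle-pred zero _ = inj₂ ((begin
    suc (suc (2 * ((n ∸ 1 + 0) % n)))   ≡⟨ cong (λ t → suc (suc (2 * (t % n)))) (+-identityʳ (n ∸ 1)) ⟩
    suc (suc (2 * ((n ∸ 1) % n)))       ≡⟨ cong (λ t → suc (suc (2 * t))) (m<n⇒m%n≡m (≤-reflexive suc[n∸1]≡n)) ⟩
    suc (suc (2 * (n ∸ 1)))             ≡⟨ *-suc 2 (n ∸ 1) ⟨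
    2 * suc (n ∸ 1)                     ≡⟨ cong (2 *_) suc[n∸1]≡n ⟩
    N                                   ∎) , refl)
    where open ≡-Reasoning
  cycle-pred (suc y) sy<n = inj₁ (trans (cong (λ t → suc (suc (2 * t))) y-residue) (sym (*-suc 2 y)))
    where
      y-residue : (n ∸ 1 + suc y) % n ≡ y
      y-residue = begin
        (n ∸ 1 + suc y) % n     ≡⟨ cong (_% n) (+-suc (n ∸ 1) y) ⟩
        (suc (n ∸ 1) + y) % n   ≡⟨ cong (λ t → (t + y) % n) suc[n∸1]≡n ⟩
        (n + y) % n             ≡⟨ cong (_% n) (+-comm n y) ⟩
        (y + n) % n             ≡⟨ [m+n]%n≡m%n y n ⟩
        y % n                   ≡⟨ m<n⇒m%n≡m (<-trans (n<1+n y) sy<n) ⟩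
        y                       ∎
        where open ≡-Reasoning

  chord-shift : ∀ y e → y < n → Antipodal (e + 2 * y) (e + 2 * ((k + y) % n))
  chord-shift y e y<n with y <? k
  ... | yes y<k = inj₁ (trans (cong (λ t → e + 2 * t) (m<n⇒m%n≡m k+y<n)) (shift e y k))
    where
      k+y<n : k + y < n
      k+y<n = subst (k + y <_) (sym n≡k+k) (+-monoʳ-< k y<k)
      shift : ∀ e y k → e + 2 * (k + y) ≡ e + 2 * y + 2 * k
      shift = solve-∀
  ... | no y≮k = let (d , k+d≡y) = m≤n⇒∃[o]m+o≡n (≮⇒≥ y≮k) in
    inj₂ (begin
      e + 2 * ((k + y) % n) + n   ≡⟨ cong (λ t → e + 2 * t + n) (residue d k+d≡y) ⟩
      e + 2 * d + 2 * k           ≡⟨ shift e d k ⟩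
      e + 2 * (k + d)             ≡⟨ cong (λ t → e + 2 * t) k+d≡y ⟩
      e + 2 * y                   ∎)
    where
      open ≡-Reasoning
      shift : ∀ e d k → e + 2 * d + 2 * k ≡ e + 2 * (k + d)
      shift = solve-∀
      residue : ∀ d → k + d ≡ y → (k + y) % n ≡ d
      residue d refl = begin
        (k + (k + d)) % n   ≡⟨ cong (_% n) (trans (sym (+-assoc k k d)) (trans (+-comm (k + k) d) (cong (d +_) (sym n≡k+k)))) ⟩
        (d + n) % n         ≡⟨ [m+n]%n≡m%n d n ⟩
        d % n               ≡⟨ m<n⇒m%n≡m (≤-<-trans (m≤n+m d k) y<n) ⟩
        d                   ∎


module Words (n : ℕ) .{{_ : NonZero n}} (S : List (D n)) where

  ShortWord : ℕ → D n → Set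
  ShortWord d x = Σ (List (D n)) λ w → All (_∈ S) w × prod n w ≡ x × length w ≤ d

  LowerBound : ℕ → D n → Set
  LowerBound d x = ∀ w → All (_∈ S) w → prod n w ≡ x → d ≤ length w

  word-induction : (P : ℕ → D n → Set) → P 0 (one n) →
                   (∀ {L s x} → s ∈ S → P L x → P (suc L) (mul n s x)) →
                   ∀ w → All (_∈ S) w → P (length w) (prod n w)
  word-induction P base step []      []         = base
  word-induction P base step (s ∷ w) (s∈S ∷ w∈S) = step s∈S (word-induction P base step w w∈S)

  isLength-intro : ∀ {d x} → ShortWord d x → LowerBound d x → IsLength n S x d
  isLength-intro (w , w∈S , w≡x , |w|≤d) lower =
    (w , w∈S , w≡x , ≤-antisym |w|≤d (lower w w∈S w≡x)) , lower

  isLength-bounded : ∀ {d x L} → ShortWord d x → IsLength n S x L → L ≤ d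
  isLength-bounded (w , w∈S , w≡x , |w|≤d) (_ , minimal) = ≤-trans (minimal w w∈S w≡x) |w|≤d

  isLambda1-intro : ∀ {d} → (∀ x → ShortWord d x) →
                    ∀ g s → s ∈ S → LowerBound d (conj n g s) → IsLambda1 n S d
  isLambda1-intro short g s s∈S lower =
    (g , s , s∈S , isLength-intro (short (conj n g s)) lower) ,
    λ g s L _ len → isLength-bounded (short (conj n g s)) len

  isLambda2-intro : ∀ {d} → (∀ x → ShortWord d x) →
                    ∀ g s s' → s ∈ S → s' ∈ S → LowerBound d (conj n g (mul n s s')) → IsLambda2 n S d
  isLambda2-intro short g s s' s∈S s'∈S lower =
    (g , s , s' , s∈S , s'∈S , isLength-intro (short (conj n g (mul n s s'))) lower) ,
    λ g s s' L _ _ len → isLength-bounded (short (conj n g (mul n s s'))) len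


module Dihedral (k : ℕ) .{{_ : NonZero k}} where

  open Cycle k
  open ZMod n

  f rf z : D n
  f  = r^f n 0
  rf = r^f n 1
  z  = r^ n k

  S : List (D n)
  S = f ∷ rf ∷ z ∷ []

  open Words n S

  pos : D n → ℕ
  pos (b , false) = 2 * toℕ b
  pos (c , true)  = suc (2 * toℕ (-ₙ c))

  pos<N : ∀ x → pos x < N
  pos<N (b , false) = *-monoʳ-< 2 (toℕ<n b)
  pos<N (c , true)  = ≤-trans (≤-reflexive (sym (*-suc 2 (toℕ (-ₙ c))))) (*-monoʳ-≤ 2 (toℕ<n (-ₙ c)))

  pos-injective : ∀ x x' → pos x ≡ pos x' → x ≡ x'
  pos-injective (b , false) (b' , false) eq = cong (_, false) (toℕ-injective (*-cancelˡ-≡ _ _ 2 eq))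
  pos-injective (c , true)  (c' , true)  eq =
    cong (_, true) (⁻¹-injective (toℕ-injective (*-cancelˡ-≡ _ _ 2 (suc-injective eq))))
  pos-injective (b , false) (c , true)   eq = ⊥-elim (even≢odd (toℕ b) (toℕ (-ₙ c)) eq)
  pos-injective (c , true)  (b , false)  eq = ⊥-elim (even≢odd (toℕ b) (toℕ (-ₙ c)) (sym eq))

  pos-one : pos (one n) ≡ 0
  pos-one = cong (2 *_) (toℕ-[<n] (>-nonZero⁻¹ n))

  [k+k]≡[0] : [ k + k ] ≡ [ 0 ]
  [k+k]≡[0] = trans (cong [_] (sym n≡k+k)) ([]-+n 0)

  -r^k≡r^k : -ₙ [ k ] ≡ [ k ]
  -r^k≡r^k = sym (inverseʳ-unique [ k ] [ k ] (trans ([]-homo k k) [k+k]≡[0]))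

  f-rotation : ∀ b → pos (mul n f (b , false)) ≡ suc (pos (b , false))
  f-rotation b = cong (λ a → suc (2 * toℕ a)) (trans (cong -ₙ_ (+-identityˡ-ℤ (-ₙ b))) (⁻¹-involutive b))

  f-reflection : ∀ c → suc (pos (mul n f (c , true))) ≡ pos (c , true)
  f-reflection c = cong (λ a → suc (2 * toℕ a)) (+-identityˡ-ℤ (-ₙ c))

  toℕ-[1] : toℕ [ 1 ] ≡ 1
  toℕ-[1] = toℕ-[<n] 1<n

  rf-rotation : ∀ b → Succ (pos (mul n rf (b , false))) (pos (b , false))
  rf-rotation b = subst (λ t → Succ (suc (2 * t)) (2 * toℕ b)) (sym residue) (cycle-pred (toℕ b) (toℕ<n b))
    where
      residue : toℕ (-ₙ ([ 1 ] +ₙ -ₙ b)) ≡ (n ∸ 1 + toℕ b) % n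
      residue = begin
        toℕ (-ₙ ([ 1 ] +ₙ -ₙ b))              ≡⟨ cong toℕ (⁻¹-∙-comm [ 1 ] (-ₙ b)) ⟨
        toℕ (-ₙ [ 1 ] +ₙ -ₙ -ₙ b)             ≡⟨ cong (λ a → toℕ (-ₙ [ 1 ] +ₙ a)) (⁻¹-involutive b) ⟩
        toℕ (-ₙ [ 1 ] +ₙ b)                   ≡⟨ toℕ-+ₙ (-ₙ [ 1 ]) b ⟩
        (toℕ (-ₙ [ 1 ]) + toℕ b) % n          ≡⟨ cong (λ t → (t + toℕ b) % n) (toℕ--ₙ [ 1 ]) ⟩
        ((n ∸ toℕ [ 1 ]) % n + toℕ b) % n     ≡⟨ %-absorbˡ (n ∸ toℕ [ 1 ]) (toℕ b) ⟩
        (n ∸ toℕ [ 1 ] + toℕ b) % n           ≡⟨ cong (λ t → (n ∸ t + toℕ b) % n) toℕ-[1] ⟩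
        (n ∸ 1 + toℕ b) % n                   ∎
        where open ≡-Reasoning

  rf-reflection : ∀ c → Succ (pos (c , true)) (pos (mul n rf (c , true)))
  rf-reflection c = subst (λ t → Succ (pos (c , true)) (2 * t)) (sym residue) (cycle-succ _ (toℕ<n (-ₙ c)))
    where
      residue : toℕ ([ 1 ] +ₙ -ₙ c) ≡ (1 + toℕ (-ₙ c)) % n
      residue = trans (toℕ-+ₙ [ 1 ] (-ₙ c)) (cong (λ t → (t + toℕ (-ₙ c)) % n) toℕ-[1])

  z-antipodal : ∀ x → Antipodal (pos x) (pos (mul n z x))
  z-antipodal (b , false) = subst (λ t → Antipodal (2 * toℕ b) (2 * t)) (sym residue) (chord-shift (toℕ b) 0 (toℕ<n b))
    where
      residue : toℕ ([ k ] +ₙ b) ≡ (k + toℕ b) % n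
      residue = trans (toℕ-+ₙ [ k ] b) (cong (λ t → (t + toℕ b) % n) (toℕ-[<n] k<n))
  z-antipodal (c , true) = subst (λ t → Antipodal (pos (c , true)) (suc (2 * t))) (sym residue) (chord-shift _ 1 (toℕ<n (-ₙ c)))
    where
      residue : toℕ (-ₙ ([ k ] +ₙ c)) ≡ (k + toℕ (-ₙ c)) % n
      residue = begin
        toℕ (-ₙ ([ k ] +ₙ c))              ≡⟨ cong toℕ (⁻¹-∙-comm [ k ] c) ⟨
        toℕ (-ₙ [ k ] +ₙ -ₙ c)             ≡⟨ cong (λ a → toℕ (a +ₙ -ₙ c)) -r^k≡r^k ⟩
        toℕ ([ k ] +ₙ -ₙ c)                ≡⟨ toℕ-+ₙ [ k ] (-ₙ c) ⟩
        (toℕ [ k ] + toℕ (-ₙ c)) % n       ≡⟨ cong (λ t → (t + toℕ (-ₙ c)) % n) (toℕ-[<n] k<n) ⟩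
        (k + toℕ (-ₙ c)) % n               ∎
        where open ≡-Reasoning

  f∈S : f ∈ S
  f∈S = here refl

  rf∈S : rf ∈ S
  rf∈S = there (here refl)

  z∈S : z ∈ S
  z∈S = there (there (here refl))

  reach-step : ∀ {L s x} → s ∈ S → Reach L (pos x) → Reach (suc L) (pos (mul n s x))
  reach-step {x = b , false} (here refl)                 = reach-adjacent (inj₁ (inj₁ (sym (f-rotation b))))
  reach-step {x = c , true}  (here refl)                 = reach-adjacent (inj₂ (inj₁ (f-reflection c)))
  reach-step {x = b , false} (there (here refl))         = reach-adjacent (inj₂ (rf-rotation b))
  reach-step {x = c , true}  (there (here refl))         = reach-adjacent (inj₁ (rf-reflection c))
  reach-step {x = x}         (there (there (here refl))) = reach-antipodal (z-antipodal x) (pos<N x) (pos<N (mul n z x))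

  far-lowerBound : ∀ x → Far (pos x) → LowerBound k x
  far-lowerBound x far w w∈S refl =
    far-unreachable (word-induction (λ L y → Reach L (pos y)) (subst (Reach 0) (sym pos-one) reach-origin) reach-step w w∈S) far

  Walk : ℕ → (ℕ → Set) → Set
  Walk L P = Σ (List (D n)) λ w → All (_∈ S) w × length w ≡ L × P (pos (prod n w))

  forward-step : ∀ y → suc (pos y) < N → Σ (D n) λ s → s ∈ S × pos (mul n s y) ≡ suc (pos y)
  forward-step (b , false) _ = f , f∈S , f-rotation b
  forward-step (c , true) sp<N with rf-reflection c
  ... | inj₁ sp≡q      = rf , rf∈S , sym sp≡q
  ... | inj₂ (sp≡N , _) = ⊥-elim (<-irrefl sp≡N sp<N)

  backward-step : ∀ y → 0 < pos y → Σ (D n) λ s → s ∈ S × suc (pos (mul n s y)) ≡ pos y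
  backward-step (b , false) 0<p with rf-rotation b
  ... | inj₁ sq≡p      = rf , rf∈S , sq≡p
  ... | inj₂ (_ , p≡0) = ⊥-elim (<-irrefl (sym p≡0) 0<p)
  backward-step (c , true) _ = f , f∈S , f-reflection c

  walk-forward : ∀ p → p < N → Walk p (_≡ p)
  walk-forward zero _ = [] , [] , refl , pos-one
  walk-forward (suc p) sp<N with walk-forward p (<-trans (n<1+n p) sp<N)
  ... | w , w∈S , refl , q≡p with forward-step (prod n w) (subst (λ t → suc t < N) (sym q≡p) sp<N)
  ...   | s , s∈S , moved = s ∷ w , s∈S ∷ w∈S , refl , trans moved (cong suc q≡p)

  walk-backward : ∀ j → j < N → Walk (suc j) (λ q → q + suc j ≡ N)
  walk-backward zero _ with rf-rotation [ 0 ]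
  ... | inj₁ sq≡p        = ⊥-elim (1+n≢0 (trans sq≡p pos-one))
  ... | inj₂ (sq≡N , _)  = rf ∷ [] , rf∈S ∷ [] , refl , trans (+-comm _ 1) sq≡N
  walk-backward (suc j) sj<N with walk-backward j (<-trans (n<1+n j) sj<N)
  ... | w , w∈S , |w|≡sj , q+sj≡N with backward-step (prod n w) (positive _ q+sj≡N)
    where
      positive : ∀ q → q + suc j ≡ N → 0 < q
      positive zero    sj≡N = ⊥-elim (<-irrefl sj≡N sj<N)
      positive (suc q) _    = s≤s z≤n
  ...   | s , s∈S , moved = s ∷ w , s∈S ∷ w∈S , cong suc |w|≡sj ,
          trans (+-suc (pos (mul n s (prod n w))) (suc j)) (trans (cong (_+ suc j) moved) q+sj≡N)

  via-forward : ∀ x → pos x ≤ k → ShortWord k x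
  via-forward x p≤k with walk-forward (pos x) (pos<N x)
  ... | w , w∈S , |w|≡p , q≡p = w , w∈S , pos-injective _ _ q≡p , ≤-trans (≤-reflexive |w|≡p) p≤k

  via-backward : ∀ x j → pos x + suc j ≡ N → suc j ≤ k → ShortWord k x
  via-backward x j p+sj≡N sj≤k with walk-backward j (≤-trans (m≤n+m (suc j) (pos x)) (≤-reflexive p+sj≡N))
  ... | w , w∈S , |w|≡sj , q+sj≡N =
    w , w∈S , pos-injective _ _ (+-cancelʳ-≡ _ _ _ (trans q+sj≡N (sym p+sj≡N))) , ≤-trans (≤-reflexive |w|≡sj) sj≤k

  via-chord-forward : ∀ x d → d + n ≡ pos x → suc d ≤ k → ShortWord k x
  via-chord-forward x d d+n≡p sd≤k with walk-forward d (<-trans sd≤k (<-trans k<n n<N))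
  ... | w , w∈S , |w|≡d , q≡d =
    z ∷ w , z∈S ∷ w∈S , pos-injective _ _ (trans chord (trans (cong (_+ n) q≡d) d+n≡p)) ,
    subst (λ t → suc t ≤ k) (sym |w|≡d) sd≤k
    where
      chord : pos (mul n z (prod n w)) ≡ pos (prod n w) + n
      chord = antipodal-low (z-antipodal (prod n w)) (subst (_< n) (sym q≡d) (<-trans sd≤k k<n))

  via-chord-backward : ∀ x j → n + pos x + suc j ≡ N → suc (suc j) ≤ k → ShortWord k x
  via-chord-backward x j n+p+sj≡N ssj≤k with walk-backward j (≤-trans (m≤n+m (suc j) (n + pos x)) (≤-reflexive n+p+sj≡N))
  ... | w , w∈S , |w|≡sj , q+sj≡N =
    z ∷ w , z∈S ∷ w∈S , pos-injective _ _ (+-cancelˡ-≡ n _ _ (trans (+-comm n _) (trans chord q≡n+p))) ,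
    subst (λ t → suc t ≤ k) (sym |w|≡sj) ssj≤k
    where
      q≡n+p : pos (prod n w) ≡ n + pos x
      q≡n+p = +-cancelʳ-≡ _ _ _ (trans q+sj≡N (sym n+p+sj≡N))
      chord : pos (mul n z (prod n w)) + n ≡ pos (prod n w)
      chord = antipodal-high (z-antipodal (prod n w)) (pos<N (mul n z (prod n w)))
                             (≤-trans (m≤m+n n (pos x)) (≤-reflexive (sym q≡n+p)))

  upper-bound : ∀ x → ShortWord k x
  upper-bound x with route (pos x) (pos<N x)
  ... | forward p≤k                   = via-forward x p≤k
  ... | backward j p+sj≡N sj≤k        = via-backward x j p+sj≡N sj≤k
  ... | chord-forward d d+n≡p sd≤k    = via-chord-forward x d d+n≡p sd≤k
  ... | chord-backward j eq ssj≤k     = via-chord-backward x j eq ssj≤k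

  -- Witnesses: every reflection is conjugate, by a rotation, to one of the generators
  -- f = r^0 f, rf = r^1 f, and to one of the products z f = r^k f, z rf = r^(k+1) f.

  conj-reflection : ∀ j t → conj n ([ j ] , false) (r^f n t) ≡ r^f n (j + t + j)
  conj-reflection j t = cong (_, true) (begin
    [ j ] +ₙ [ t ] +ₙ -ₙ -ₙ [ j ]   ≡⟨ cong ([ j ] +ₙ [ t ] +ₙ_) (⁻¹-involutive [ j ]) ⟩
    [ j ] +ₙ [ t ] +ₙ [ j ]         ≡⟨ cong (_+ₙ [ j ]) ([]-homo j t) ⟩
    [ j + t ] +ₙ [ j ]              ≡⟨ []-homo (j + t) j ⟩
    [ j + t + j ]                   ∎)
    where open ≡-Reasoning

  -- conjugating r^(d+e) f by r^j gives r^(2j+d+e) f; choose 2j + e = c + d, using 2d ≡ 0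
  reflection-conjugate : ∀ d → [ d + d ] ≡ [ 0 ] → ∀ c →
                         Σ ℕ λ j → Σ ℕ λ e → e ≤ 1 × conj n ([ j ] , false) (r^f n (d + e)) ≡ (c , true)
  reflection-conjugate d [d+d]≡[0] c with parity (toℕ c + d)
  ... | j , e , e≤1 , j+e+j≡c+d = j , e , e≤1 , (begin
    conj n ([ j ] , false) (r^f n (d + e))   ≡⟨ conj-reflection j (d + e) ⟩
    ([ j + (d + e) + j ] , true)             ≡⟨ cong (λ t → [ t ] , true) rearrange ⟩
    ([ toℕ c + (d + d) ] , true)             ≡⟨ cong (_, true) ([]-homo (toℕ c) (d + d)) ⟨
    ([ toℕ c ] +ₙ [ d + d ] , true)          ≡⟨ cong (λ a → [ toℕ c ] +ₙ a , true) [d+d]≡[0] ⟩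
    ([ toℕ c ] +ₙ [ 0 ] , true)              ≡⟨ cong (_, true) (trans (+-identityʳ-ℤ [ toℕ c ]) ([]-toℕ c)) ⟩
    (c , true)                               ∎)
    where
      open ≡-Reasoning
      shuffle : ∀ j d e → j + (d + e) + j ≡ j + e + j + d
      shuffle = solve-∀
      rearrange : j + (d + e) + j ≡ toℕ c + (d + d)
      rearrange = trans (shuffle j d e) (trans (cong (_+ d) j+e+j≡c+d) (+-assoc (toℕ c) d d))

  reflection-generator : ∀ {e} → e ≤ 1 → r^f n e ∈ S
  reflection-generator z≤n       = f∈S
  reflection-generator (s≤s z≤n) = rf∈S

  z-reflection : ∀ e → mul n z (r^f n e) ≡ r^f n (k + e)
  z-reflection e = cong (_, true) ([]-homo k e)

  -- the reflection r^(-y) f with y = ⌊k/2⌋ sits at position 2y + 1 ∈ {k, k + 1}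
  far-reflection : Σ (Fin n) λ c → Far (pos (c , true))
  far-reflection with parity k
  ... | y , e , e≤1 , y+e+y≡k = -ₙ [ y ] , subst Far (sym pos≡2y+1) (far-odd y e e≤1 y+e+y≡k)
    where
      y<n : y < n
      y<n = ≤-<-trans (≤-trans (m≤m+n y e) (≤-trans (m≤m+n (y + e) y) (≤-reflexive y+e+y≡k))) k<n
      pos≡2y+1 : pos (-ₙ [ y ] , true) ≡ suc (2 * y)
      pos≡2y+1 = trans (cong (λ a → suc (2 * toℕ a)) (⁻¹-involutive [ y ])) (cong (λ t → suc (2 * t)) (toℕ-[<n] y<n))

  far-conjugate : Σ (D n) λ g → Σ (D n) λ s → s ∈ S × LowerBound k (conj n g s)
  far-conjugate with far-reflection
  ... | c , far with reflection-conjugate 0 refl c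
  ...   | j , e , e≤1 , conj≡c =
    ([ j ] , false) , r^f n e , reflection-generator e≤1 , subst (LowerBound k) (sym conj≡c) (far-lowerBound (c , true) far)

  far-conjugate₂ : Σ (D n) λ g → Σ (D n) λ s → Σ (D n) λ s' → s ∈ S × s' ∈ S × LowerBound k (conj n g (mul n s s'))
  far-conjugate₂ with far-reflection
  ... | c , far with reflection-conjugate k [k+k]≡[0] c
  ...   | j , e , e≤1 , conj≡c =
    ([ j ] , false) , z , r^f n e , z∈S , reflection-generator e≤1 ,
    subst (LowerBound k) (sym (trans (cong (conj n ([ j ] , false)) (z-reflection e)) conj≡c)) (far-lowerBound (c , true) far)


theorem7 : (m : ℕ) →
    IsLambda1 (2 * (2 + m)) (r^f (2 * (2 + m)) 0 ∷ r^f (2 * (2 + m)) 1 ∷ r^ (2 * (2 + m)) (2 + m) ∷ []) (2 + m)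
    × IsLambda2 (2 * (2 + m)) (r^f (2 * (2 + m)) 0 ∷ r^f (2 * (2 + m)) 1 ∷ r^ (2 * (2 + m)) (2 + m) ∷ []) (2 + m)
theorem7 m =
  (let (g , s , s∈S , far) = far-conjugate in isLambda1-intro upper-bound g s s∈S far) ,
  (let (g , s , s' , s∈S , s'∈S , far) = far-conjugate₂ in isLambda2-intro upper-bound g s s' s∈S s'∈S far)
  where
    open Dihedral (2 + m)
    open Words (2 * (2 + m)) S
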